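{- Let $k\ge 1$ and $J=\{1,2,\dots,k\}$. Then for every integer $n\ge 1$, \[ \varphi_J(n)=J_k(n), \] where $J_k(n)=n^k\prod_{p\mid n}\left(1-p^{ -k}\right)$ is Jordan's totient function.
   Context: For $J=\{j_1,\dots,j_m\}\subseteq\{1,\dots,k\}$, $\varphi_J(n)$ is the number of $(x_1,\dots,x_k)\in\mathbb{Z}_n^k$ with $\gcd(e_{j_1}(x_1,\dots,x_k),\dots,e_{j_m}(x_1,\dots,x_k),n)=1$, where $e_j$ is the $j$-th elementary symmetric polynomial in $k$ variables. -}

module Defs where

open import Data.Nat using (ℕ; zero; suc; _+_; _*_; _^_; NonZero) renaming (_≟_ to _≟ℕ_)
open import Data.Nat.Properties using (m^n≢0)
open import Data.Nat.GCD using (gcd)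
open import Data.Nat.Divisibility using (_∣?_)
open import Data.Nat.Primality using (prime?)
open import Data.Fin using (Fin; toℕ)
open import Data.Vec using (Vec; []; _∷_; toList)
open import Data.List using (List; []; _∷_; [_]; map; concatMap; filter; length; foldr; allFin; upTo)
open import Data.Integer using (+_)
open import Data.Rational using (ℚ; _/_; 1ℚ; _-_) renaming (_*_ to _*ℚ_)
open import Relation.Nullary.Decidable using (_×-dec_)

-- e j xs : the j-th elementary symmetric polynomial evaluated at the list xs
-- (e 0 = 1; e j of fewer than j variables is 0).
e : ℕ → List ℕ → ℕ
e zero      _        = 1
e (suc j)   []       = 0
e (suc j)   (x ∷ xs) = x * e j xs + e (suc j) xs

allTuples : (k n : ℕ) → List (Vec (Fin n) k)
allTuples zero    n = [ [] ]
allTuples (suc k) n = concatMap (λ i → map (i ∷_) (allTuples k n)) (allFin n)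

-- gcd(e_{j1}(x), ..., e_{jm}(x), n), with x_i represented by 0 ≤ x_i < n
-- (gcd with n only depends on the residue mod n)
gcdJ : {k n : ℕ} → List ℕ → Vec (Fin n) k → ℕ
gcdJ {k} {n} J x = foldr (λ j g → gcd (e j (map toℕ (toList x))) g) n J

φ : (k : ℕ) → (J : List ℕ) → (n : ℕ) → ℕ
φ k J n = length (filter (λ x → gcdJ J x ≟ℕ 1) (allTuples k n))

recipPow : ℕ → ℕ → ℚ
recipPow i k = (+ 1) / (suc i ^ k)
  where instance _ = m^n≢0 (suc i) k

-- Jordan's totient  J_k(n) = n^k ∏_{p | n, p prime} (1 - p^{-k}), as a rational;
-- primes p dividing n (n ≥ 1) satisfy 1 ≤ p ≤ n, enumerated as p = suc i, i < n.
jordan : (k n : ℕ) → ℚ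
jordan k n =
  ((+ (n ^ k)) / 1) *ℚ
  foldr (λ i acc → (1ℚ - recipPow i k) *ℚ acc) 1ℚ
        (filter (λ i → prime? (suc i) ×-dec (suc i ∣? n)) (upTo n))

fullJ : ℕ → List ℕ
fullJ k = map suc (upTo k)

{-# OPTIONS --safe #-}

-- A prime p divides e₁(x), …, e_k(x) iff it divides every xᵢ: modulo p the xᵢ are the roots
-- of tᵏ − e₁ tᵏ⁻¹ + ⋯ ± e_k, which is then tᵏ. So φ_J(n) counts the tuples in ℤₙᵏ that are
-- not divisible (entrywise) by any prime divisor of n. The divisible ones are sieved out one
-- prime at a time: for n = m p the tuples divisible by p are p times the tuples in ℤₘᵏ, and the condition
-- for the remaining primes only depends on the entries modulo m, so removing p multiplies the
-- count by (pᵏ − 1) / pᵏ = 1 − p⁻ᵏ.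

module Submission where

open import Defs
open import Data.Fin using (Fin; toℕ)
open import Data.Integer as ℤ using (+_)
import Data.Integer.Properties as ℤ
open import Data.List using (List; []; _∷_; _++_; map; foldr; filter; upTo; length; tabulate; concatMap; allFin)
open import Data.List.Properties using (map-++; map-∘; map-cong; map-tabulate)
open import Data.List.Membership.Propositional.Properties using (∈-filter⁺; ∈-filter⁻; ∈-upTo⁺; ∈-upTo⁻)
open import Data.List.Relation.Unary.All as All using (All; []; _∷_; all?; lookup; zipWith)
open import Data.List.Relation.Unary.All.Properties using (map⁺; map⁻; all-filter)
open import Data.List.Relation.Unary.AllPairs using (_∷_)
open import Data.List.Relation.Unary.Unique.Propositional using (Unique)
open import Data.List.Relation.Unary.Unique.Propositional.Properties using (filter⁺; upTo⁺)
open import Data.Nat using (ℕ; zero; suc; _+_; _*_; _∸_; _^_; _≤_; _<_; s≤s; s<s; z<s; NonZero; >-nonZero)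
  renaming (_≟_ to _≟ℕ_)
open import Data.Nat.Divisibility
  using (_∣_; divides; _∣?_; _∣0; ∣-refl; ∣-trans; ∣1⇒≡1; ∣⇒≤; ∣m⇒∣m*n; ∣n⇒∣m*n; ∣m+n∣m⇒∣n; ∣m∣n⇒∣m+n)
open import Data.Nat.GCD using (gcd; gcd[m,n]∣m; gcd[m,n]∣n; gcd-greatest)
open import Data.Nat.ListAction using (sum; product)
open import Data.Nat.ListAction.Properties using (sum-++)
open import Data.Nat.Primality using (Prime; prime?; euclidsLemma; prime⇒irreducible; ¬prime[0]; ¬prime[1]; prime[2])
open import Data.Nat.Primality.Factorisation using (factorise)
open import Data.Nat.Properties
  using ( +-assoc; +-identityʳ; +-suc; *-comm; *-assoc; *-zeroʳ; *-suc; *-identityˡ; *-identityʳ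
        ; *-distribˡ-+; *-distribʳ-∸; m+n∸n≡m; suc-injective; m≤n+m; m≤n⇒m≤1+n; ≤-refl; <⇒≱; m^n≢0
        ; +-commutativeSemigroup; *-commutativeSemigroup)
open import Algebra.Properties.CommutativeSemigroup +-commutativeSemigroup
  using () renaming (interchange to +-interchange)
open import Algebra.Properties.CommutativeSemigroup *-commutativeSemigroup
  using () renaming (x∙yz≈yx∙z to *-x∙yz≈yx∙z)
import Data.Nat.Solver
open import Data.Product using (_×_; _,_; proj₁; proj₂; ∃-syntax)
open import Data.Rational using (ℚ; _/_; 1ℚ; _-_; fromℚᵘ; toℚᵘ) renaming (_*_ to _*ℚ_; _+_ to _+ℚ_)
import Data.Rational.Properties as ℚ
import Data.Rational.Solver
import Data.Rational.Unnormalised as ℚᵘ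
import Data.Rational.Unnormalised.Properties as ℚᵘ
open import Data.Sum using ([_,_]′; inj₁; inj₂)
open import Data.Vec using (Vec; _∷_; toList)
open import Function using (_∘_; id; _⇔_; mk⇔; Equivalence)
open import Function.Properties.Equivalence using () renaming (sym to ⇔-sym)
open import Function.Related.Propositional using (module EquationalReasoning)
open import Relation.Binary.PropositionalEquality hiding (J)
open import Relation.Nullary using (Dec; yes; no; ¬_; ¬?; contradiction)
open import Relation.Nullary.Decidable using (_×-dec_)
open import Relation.Unary using (Decidable)

𝟙[_] : ∀ {a} {P : Set a} → Dec P → ℕ
𝟙[ yes _ ] = 1
𝟙[ no  _ ] = 0

𝟙-cong : ∀ {a b} {P : Set a} {Q : Set b} → P ⇔ Q → (P? : Dec P) (Q? : Dec Q) → 𝟙[ P? ] ≡ 𝟙[ Q? ]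
𝟙-cong _   (yes _) (yes _) = refl
𝟙-cong P⇔Q (yes p) (no ¬q) = contradiction (Equivalence.to P⇔Q p) ¬q
𝟙-cong P⇔Q (no ¬p) (yes q) = contradiction (Equivalence.from P⇔Q q) ¬p
𝟙-cong _   (no _)  (no _)  = refl

𝟙-yes : ∀ {a} {P : Set a} → P → (P? : Dec P) → 𝟙[ P? ] ≡ 1
𝟙-yes _ (yes _) = refl
𝟙-yes p (no ¬p) = contradiction p ¬p

𝟙-no : ∀ {a} {P : Set a} → ¬ P → (P? : Dec P) → 𝟙[ P? ] ≡ 0
𝟙-no ¬p (yes p) = contradiction p ¬p
𝟙-no _  (no _)  = refl

𝟙[¬?]*n+𝟙*n≡n : ∀ {a} {P : Set a} (P? : Dec P) n → 𝟙[ ¬? P? ] * n + 𝟙[ P? ] * n ≡ n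
𝟙[¬?]*n+𝟙*n≡n (yes _) n = +-identityʳ n
𝟙[¬?]*n+𝟙*n≡n (no  _) n = trans (+-identityʳ (n + 0)) (+-identityʳ n)

𝟙-all?-∷ : ∀ {a p} {A : Set a} {P : A → Set p} (P? : Decidable P) x xs →
           𝟙[ all? P? (x ∷ xs) ] ≡ 𝟙[ P? x ] * 𝟙[ all? P? xs ]
𝟙-all?-∷ P? x xs with P? x | all? P? xs
... | yes _ | yes _ = refl
... | yes _ | no  _ = refl
... | no  _ | _     = refl

length-filter≡sum-𝟙 : ∀ {A : Set} {P : A → Set} (P? : Decidable P) xs →
                      length (filter P? xs) ≡ sum (map (𝟙[_] ∘ P?) xs)
length-filter≡sum-𝟙 P? []       = refl
length-filter≡sum-𝟙 P? (x ∷ xs) with P? x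
... | yes _ = cong suc (length-filter≡sum-𝟙 P? xs)
... | no  _ = length-filter≡sum-𝟙 P? xs

∣m+n⇔∣n : ∀ {d m n} → d ∣ m → d ∣ m + n ⇔ d ∣ n
∣m+n⇔∣n d∣m = mk⇔ (λ d∣m+n → ∣m+n∣m⇒∣n d∣m+n d∣m) (∣m∣n⇒∣m+n d∣m)

prime∤1 : ∀ {p} → Prime p → ¬ p ∣ 1
prime∤1 p-prime p∣1 = contradiction (subst Prime (∣1⇒≡1 p∣1) p-prime) ¬prime[1]

prime∤prime : ∀ {q p} → Prime q → Prime p → q ≢ p → ¬ q ∣ p
prime∤prime q-prime p-prime q≢p q∣p with prime⇒irreducible p-prime q∣p
... | inj₁ refl = contradiction q-prime ¬prime[1]
... | inj₂ q≡p  = q≢p q≡p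

prime∣m*n⇔∣n : ∀ {q m n} → Prime q → ¬ q ∣ m → q ∣ m * n ⇔ q ∣ n
prime∣m*n⇔∣n {m = m} {n} q-prime q∤m =
  mk⇔ (λ q∣mn → [ (λ q∣m → contradiction q∣m q∤m) , id ]′ (euclidsLemma m n q-prime q∣mn)) (∣n⇒∣m*n m)

prime∣m^n⇒∣m : ∀ {p m} n → Prime p → p ∣ m ^ n → p ∣ m
prime∣m^n⇒∣m         zero    p-prime p∣1   = contradiction p∣1 (prime∤1 p-prime)
prime∣m^n⇒∣m {m = m} (suc n) p-prime p∣m^n =
  [ id , prime∣m^n⇒∣m n p-prime ]′ (euclidsLemma m (m ^ n) p-prime p∣m^n)

prime-factor : ∀ g → g ≢ 1 → ∃[ p ] Prime p × p ∣ g
prime-factor zero      _   = 2 , prime[2] , 2 ∣0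
prime-factor g@(suc _) g≢1 with factorise g
... | record { factors = []     ; isFactorisation = g≡1 } = contradiction g≡1 g≢1
... | record { factors = q ∷ qs ; isFactorisation = g≡∏ ; factorsPrime = q-prime ∷ _ } =
  q , q-prime , subst (q ∣_) (sym g≡∏) (∣m⇒∣m*n (product qs) ∣-refl)

≡1⇔no-prime-divisor : ∀ g → g ≡ 1 ⇔ (∀ {p} → Prime p → ¬ p ∣ g)
≡1⇔no-prime-divisor g = mk⇔ (λ { refl → prime∤1 }) from
  where
  from : (∀ {p} → Prime p → ¬ p ∣ g) → g ≡ 1
  from no-divisor with g ≟ℕ 1
  ... | yes g≡1 = g≡1
  ... | no  g≢1 with prime-factor g g≢1
  ...   | _ , p-prime , p∣g = contradiction p∣g (no-divisor p-prime)

∑< : ℕ → (ℕ → ℕ) → ℕ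
∑< zero    f = 0
∑< (suc n) f = f 0 + ∑< n (f ∘ suc)

syntax ∑< n (λ i → t) = ∑[ i < n ] t

∑<-cong : ∀ n {f g : ℕ → ℕ} → (∀ {i} → i < n → f i ≡ g i) → ∑< n f ≡ ∑< n g
∑<-cong zero    _   = refl
∑<-cong (suc n) f≗g = cong₂ _+_ (f≗g z<s) (∑<-cong n (f≗g ∘ s<s))

∑<-const : ∀ n c → ∑[ _ < n ] c ≡ n * c
∑<-const zero    c = refl
∑<-const (suc n) c = cong₂ _+_ refl (∑<-const n c)

∑<-distrib-+ : ∀ n (f g : ℕ → ℕ) → ∑[ i < n ] (f i + g i) ≡ ∑< n f + ∑< n g
∑<-distrib-+ zero    f g = refl
∑<-distrib-+ (suc n) f g = begin
  f 0 + g 0 + ∑[ i < n ] (f (suc i) + g (suc i))  ≡⟨ cong₂ _+_ refl (∑<-distrib-+ n (f ∘ suc) (g ∘ suc)) ⟩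
  f 0 + g 0 + (∑< n (f ∘ suc) + ∑< n (g ∘ suc))   ≡⟨ +-interchange (f 0) (g 0) _ _ ⟩
  f 0 + ∑< n (f ∘ suc) + (g 0 + ∑< n (g ∘ suc))   ∎
  where open ≡-Reasoning

∑<-distribˡ-* : ∀ n c (f : ℕ → ℕ) → ∑[ i < n ] (c * f i) ≡ c * ∑< n f
∑<-distribˡ-* zero    c f = sym (*-zeroʳ c)
∑<-distribˡ-* (suc n) c f =
  trans (cong₂ _+_ refl (∑<-distribˡ-* n c (f ∘ suc))) (sym (*-distribˡ-+ c (f 0) _))

∑<-+ : ∀ m n (f : ℕ → ℕ) → ∑< (m + n) f ≡ ∑< m f + ∑[ i < n ] f (m + i)
∑<-+ zero    n f = refl
∑<-+ (suc m) n f = trans (cong₂ _+_ refl (∑<-+ m n (f ∘ suc))) (sym (+-assoc (f 0) _ _))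

∑<-periodic : ∀ p m (f : ℕ → ℕ) → (∀ i → f (m + i) ≡ f i) → ∑< (p * m) f ≡ p * ∑< m f
∑<-periodic zero    m f _   = refl
∑<-periodic (suc p) m f per = begin
  ∑< (m + p * m) f                    ≡⟨ ∑<-+ m (p * m) f ⟩
  ∑< m f + ∑[ i < p * m ] f (m + i)   ≡⟨ cong₂ _+_ refl (∑<-cong (p * m) (λ {i} _ → per i)) ⟩
  ∑< m f + ∑< (p * m) f               ≡⟨ cong₂ _+_ refl (∑<-periodic p m f per) ⟩
  ∑< m f + p * ∑< m f                 ∎
  where open ≡-Reasoning

∑<-multiples : ∀ m d (g : ℕ → ℕ) →
               ∑[ i < m * suc d ] (𝟙[ suc d ∣? i ] * g i) ≡ ∑[ j < m ] g (suc d * j)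
∑<-multiples zero    d g = refl
∑<-multiples (suc m) d g = begin
  ∑< (p + m * p) h                                 ≡⟨ ∑<-+ p (m * p) h ⟩
  ∑< p h + ∑[ i < m * p ] h (p + i)                ≡⟨ cong₂ _+_ block (∑<-cong (m * p) shift) ⟩
  g 0 + ∑[ i < m * p ] (𝟙[ p ∣? i ] * g (p + i))   ≡⟨ cong₂ _+_ refl (∑<-multiples m d (λ i → g (p + i))) ⟩
  g 0 + ∑[ j < m ] g (p + p * j)                   ≡⟨ cong₂ _+_ (cong g (sym (*-zeroʳ p)))
                                                                (∑<-cong m (λ {j} _ → cong g (sym (*-suc p j)))) ⟩
  g (p * 0) + ∑[ j < m ] g (p * suc j)             ∎
  where
  open ≡-Reasoning
  p = suc d
  h : ℕ → ℕ
  h i = 𝟙[ p ∣? i ] * g i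
  p∤1+i : ∀ {i} → i < d → h (suc i) ≡ 0
  p∤1+i {i} i<d = cong (_* g (suc i)) (𝟙-no (λ p∣1+i → <⇒≱ (s<s i<d) (∣⇒≤ p∣1+i)) (p ∣? suc i))
  block : ∑< p h ≡ g 0
  block = begin
    𝟙[ p ∣? 0 ] * g 0 + ∑[ i < d ] h (suc i)  ≡⟨ cong₂ (λ a b → a * g 0 + b) (𝟙-yes (p ∣0) (p ∣? 0))
                                                                                (∑<-cong d p∤1+i) ⟩
    1 * g 0 + ∑[ _ < d ] 0                   ≡⟨ cong₂ _+_ refl (trans (∑<-const d 0) (*-zeroʳ d)) ⟩
    1 * g 0 + 0                              ≡⟨ trans (+-identityʳ _) (*-identityˡ _) ⟩
    g 0                                      ∎
  shift : ∀ {i} → i < m * p → h (p + i) ≡ 𝟙[ p ∣? i ] * g (p + i)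
  shift {i} _ = cong (_* g (p + i)) (𝟙-cong (∣m+n⇔∣n ∣-refl) (p ∣? p + i) (p ∣? i))

∑Tuples : (k n : ℕ) → (List ℕ → ℕ) → ℕ
∑Tuples zero    n w = w []
∑Tuples (suc k) n w = ∑[ x < n ] ∑Tuples k n (w ∘ (x ∷_))

∑Tuples-cong : ∀ k n {w v : List ℕ → ℕ} → (∀ {xs} → length xs ≡ k → w xs ≡ v xs) →
               ∑Tuples k n w ≡ ∑Tuples k n v
∑Tuples-cong zero    n w≗v = w≗v refl
∑Tuples-cong (suc k) n w≗v = ∑<-cong n (λ _ → ∑Tuples-cong k n (w≗v ∘ cong suc))

∑Tuples-1 : ∀ k n → ∑Tuples k n (λ _ → 1) ≡ n ^ k
∑Tuples-1 zero    n = refl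
∑Tuples-1 (suc k) n = trans (∑<-cong n (λ _ → ∑Tuples-1 k n)) (∑<-const n (n ^ k))

∑Tuples-distrib-+ : ∀ k n (w v : List ℕ → ℕ) →
                    ∑Tuples k n (λ xs → w xs + v xs) ≡ ∑Tuples k n w + ∑Tuples k n v
∑Tuples-distrib-+ zero    n w v = refl
∑Tuples-distrib-+ (suc k) n w v =
  trans (∑<-cong n (λ {x} _ → ∑Tuples-distrib-+ k n (w ∘ (x ∷_)) (v ∘ (x ∷_)))) (∑<-distrib-+ n _ _)

∑Tuples-distribˡ-* : ∀ k n c (w : List ℕ → ℕ) → ∑Tuples k n (λ xs → c * w xs) ≡ c * ∑Tuples k n w
∑Tuples-distribˡ-* zero    n c w = refl
∑Tuples-distribˡ-* (suc k) n c w =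
  trans (∑<-cong n (λ {x} _ → ∑Tuples-distribˡ-* k n c (w ∘ (x ∷_)))) (∑<-distribˡ-* n c _)

Periodic : ℕ → (List ℕ → ℕ) → Set
Periodic m w = ∀ pre x post → w (pre ++ m + x ∷ post) ≡ w (pre ++ x ∷ post)

∑Tuples-periodic : ∀ k p m {w : List ℕ → ℕ} → Periodic m w → ∑Tuples k (p * m) w ≡ p ^ k * ∑Tuples k m w
∑Tuples-periodic zero    p m     per = sym (+-identityʳ _)
∑Tuples-periodic (suc k) p m {w} per = begin
  ∑[ x < p * m ] ∑Tuples k (p * m) (w ∘ (x ∷_))
    ≡⟨ ∑<-cong (p * m) (λ {x} _ → ∑Tuples-periodic k p m (λ pre → per (x ∷ pre))) ⟩
  ∑[ x < p * m ] (p ^ k * ∑Tuples k m (w ∘ (x ∷_)))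
    ≡⟨ ∑<-distribˡ-* (p * m) (p ^ k) _ ⟩
  p ^ k * ∑[ x < p * m ] ∑Tuples k m (w ∘ (x ∷_))
    ≡⟨ cong (p ^ k *_) (∑<-periodic p m _ (λ x → ∑Tuples-cong k m (λ {xs} _ → per [] x xs))) ⟩
  p ^ k * (p * ∑[ x < m ] ∑Tuples k m (w ∘ (x ∷_)))
    ≡⟨ *-x∙yz≈yx∙z (p ^ k) p _ ⟩
  p * p ^ k * ∑[ x < m ] ∑Tuples k m (w ∘ (x ∷_))
    ∎
  where open ≡-Reasoning

∑Tuples-multiples : ∀ k m d (w : List ℕ → ℕ) →
                    ∑Tuples k (m * suc d) (λ xs → 𝟙[ all? (suc d ∣?_) xs ] * w xs)
                    ≡ ∑Tuples k m (w ∘ map (suc d *_))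
∑Tuples-multiples zero    m d w = +-identityʳ (w [])
∑Tuples-multiples (suc k) m d w = begin
  ∑[ x < m * p ] ∑Tuples k (m * p) (λ xs → 𝟙[ all? (p ∣?_) (x ∷ xs) ] * w (x ∷ xs))
    ≡⟨ ∑<-cong (m * p) (λ {x} _ → trans (∑Tuples-cong k (m * p) (λ {xs} _ → split x xs))
                                         (∑Tuples-distribˡ-* k (m * p) 𝟙[ p ∣? x ] _)) ⟩
  ∑[ x < m * p ] (𝟙[ p ∣? x ] * ∑Tuples k (m * p) (λ xs → 𝟙[ all? (p ∣?_) xs ] * w (x ∷ xs)))
    ≡⟨ ∑<-cong (m * p) (λ {x} _ → cong (𝟙[ p ∣? x ] *_) (∑Tuples-multiples k m d (w ∘ (x ∷_)))) ⟩
  ∑[ x < m * p ] (𝟙[ p ∣? x ] * ∑Tuples k m (λ ys → w (x ∷ map (p *_) ys)))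
    ≡⟨ ∑<-multiples m d _ ⟩
  ∑[ j < m ] ∑Tuples k m (λ ys → w (p * j ∷ map (p *_) ys))
    ∎
  where
  open ≡-Reasoning
  p = suc d
  split : ∀ x xs → 𝟙[ all? (p ∣?_) (x ∷ xs) ] * w (x ∷ xs) ≡ 𝟙[ p ∣? x ] * (𝟙[ all? (p ∣?_) xs ] * w (x ∷ xs))
  split x xs = trans (cong (_* w (x ∷ xs)) (𝟙-all?-∷ (p ∣?_) x xs)) (*-assoc 𝟙[ p ∣? x ] _ _)

sum-map-concatMap : ∀ {A B : Set} (f : B → ℕ) (g : A → List B) xs →
                    sum (map f (concatMap g xs)) ≡ sum (map (sum ∘ map f ∘ g) xs)
sum-map-concatMap f g []       = refl
sum-map-concatMap f g (x ∷ xs) = begin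
  sum (map f (g x ++ concatMap g xs))                 ≡⟨ cong sum (map-++ f (g x) (concatMap g xs)) ⟩
  sum (map f (g x) ++ map f (concatMap g xs))         ≡⟨ sum-++ (map f (g x)) _ ⟩
  sum (map f (g x)) + sum (map f (concatMap g xs))    ≡⟨ cong₂ _+_ refl (sum-map-concatMap f g xs) ⟩
  sum (map f (g x)) + sum (map (sum ∘ map f ∘ g) xs)  ∎
  where open ≡-Reasoning

sum-tabulate-toℕ : ∀ n (f : ℕ → ℕ) → sum (tabulate (f ∘ toℕ {n})) ≡ ∑< n f
sum-tabulate-toℕ zero    f = refl
sum-tabulate-toℕ (suc n) f = cong₂ _+_ refl (sum-tabulate-toℕ n (f ∘ suc))

entries : ∀ {k n} → Vec (Fin n) k → List ℕ
entries = map toℕ ∘ toList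

sum-allTuples : ∀ k n (w : List ℕ → ℕ) → sum (map (w ∘ entries) (allTuples k n)) ≡ ∑Tuples k n w
sum-allTuples zero    n w = +-identityʳ (w [])
sum-allTuples (suc k) n w = begin
  sum (map (w ∘ entries) (concatMap (λ i → map (i ∷_) (allTuples k n)) (allFin n)))
    ≡⟨ sum-map-concatMap (w ∘ entries) _ (allFin n) ⟩
  sum (map (λ i → sum (map (w ∘ entries) (map (i ∷_) (allTuples k n)))) (allFin n))
    ≡⟨ cong sum (map-cong (λ i → cong sum (sym (map-∘ (allTuples k n)))) (allFin n)) ⟩
  sum (map (λ i → sum (map (w ∘ (toℕ i ∷_) ∘ entries) (allTuples k n))) (allFin n))
    ≡⟨ cong sum (map-cong (λ i → sum-allTuples k n (w ∘ (toℕ i ∷_))) (allFin n)) ⟩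
  sum (map (λ i → ∑Tuples k n (w ∘ (toℕ i ∷_))) (allFin n))
    ≡⟨ cong sum (map-tabulate {n = n} id (λ i → ∑Tuples k n (w ∘ (toℕ i ∷_)))) ⟩
  sum (tabulate (λ (i : Fin n) → ∑Tuples k n (w ∘ (toℕ i ∷_))))
    ≡⟨ sum-tabulate-toℕ n (λ x → ∑Tuples k n (w ∘ (x ∷_))) ⟩
  ∑[ x < n ] ∑Tuples k n (w ∘ (x ∷_))
    ∎
  where open ≡-Reasoning

-- Elementary symmetric polynomials modulo a prime

e-vanishes : ∀ xs j → length xs ≤ j → e (suc j) xs ≡ 0
e-vanishes []       j       _         = refl
e-vanishes (x ∷ xs) (suc j) (s≤s k≤j)
  rewrite e-vanishes xs j k≤j | e-vanishes xs (suc j) (m≤n⇒m≤1+n k≤j) = trans (+-identityʳ (x * 0)) (*-zeroʳ x)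

All∣⇒∣e : ∀ {d xs} → All (d ∣_) xs → ∀ j → d ∣ e (suc j) xs
All∣⇒∣e {d} []                           j = d ∣0
All∣⇒∣e     {xs = x ∷ xs} (d∣x ∷ d∣xs)   j = ∣m∣n⇒∣m+n (∣m⇒∣m*n (e j xs) d∣x) (All∣⇒∣e d∣xs j)

-- Since x^(i+1) e_j(xs) + x^i e_(j+1)(xs) = x^i e_(j+1)(x ∷ xs), divisibility passes from
-- x^i e_(j+1)(xs) to x^(i+1) e_j(xs); it starts at e_(k+1)(xs) = 0 and ends at x^(k+1) e_0(xs).
∣x^i*e : ∀ {d} x xs → (∀ j → j ≤ length xs → d ∣ e (suc j) (x ∷ xs)) →
         ∀ i j → i + j ≡ suc (length xs) → d ∣ x ^ i * e j xs
∣x^i*e {d} x xs d∣e zero    j refl = subst (λ t → d ∣ 1 * t) (sym (e-vanishes xs (length xs) ≤-refl)) (d ∣0)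
∣x^i*e {d} x xs d∣e (suc i) j i+j≡k+1 =
  ∣m+n∣m⇒∣n (subst (d ∣_) (expand (x ^ i) x (e j xs) (e (suc j) xs)) (∣n⇒∣m*n (x ^ i) (d∣e j j≤k)))
            (∣x^i*e x xs d∣e i (suc j) (trans (+-suc i j) i+j≡k+1))
  where
  j≤k : j ≤ length xs
  j≤k = subst (j ≤_) (suc-injective i+j≡k+1) (m≤n+m j i)
  expand : ∀ y x a b → y * (x * a + b) ≡ y * b + x * y * a
  expand = solve 4 (λ y x a b → y :* (x :* a :+ b) := y :* b :+ x :* y :* a) refl
    where open Data.Nat.Solver.+-*-Solver

∣e⇒All∣ : ∀ {p} → Prime p → ∀ xs → (∀ j → j < length xs → p ∣ e (suc j) xs) → All (p ∣_) xs
∣e⇒All∣         p-prime []       _   = []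
∣e⇒All∣ {p} p-prime (x ∷ xs) p∣e = p∣x ∷ ∣e⇒All∣ p-prime xs p∣e[xs]
  where
  k = length xs
  p∣x : p ∣ x
  p∣x = prime∣m^n⇒∣m (suc k) p-prime (subst (p ∣_) (*-identityʳ _)
          (∣x^i*e x xs (λ j j≤k → p∣e j (s≤s j≤k)) (suc k) 0 (cong suc (+-identityʳ k))))
  p∣e[xs] : ∀ j → j < k → p ∣ e (suc j) xs
  p∣e[xs] j j<k = ∣m+n∣m⇒∣n (p∣e j (m≤n⇒m≤1+n j<k)) (∣m⇒∣m*n (e j xs) p∣x)

All-fullJ⇔ : ∀ {P : ℕ → Set} k → All P (fullJ k) ⇔ (∀ j → j < k → P (suc j))
All-fullJ⇔ k = mk⇔ (λ all j j<k → lookup (map⁻ all) (∈-upTo⁺ j<k))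
                   (λ h → map⁺ (All.tabulate (λ j∈ → h _ (∈-upTo⁻ j∈))))

∣e⇔All∣ : ∀ {p} → Prime p → ∀ xs → All (λ j → p ∣ e j xs) (fullJ (length xs)) ⇔ All (p ∣_) xs
∣e⇔All∣ p-prime xs = mk⇔ (∣e⇒All∣ p-prime xs ∘ Equivalence.to (All-fullJ⇔ (length xs)))
                         (λ p∣xs → Equivalence.from (All-fullJ⇔ (length xs)) (λ j _ → All∣⇒∣e p∣xs j))

gcdE : ℕ → List ℕ → List ℕ → ℕ
gcdE n J xs = foldr (λ j g → gcd (e j xs) g) n J

∣gcdE⇔ : ∀ {d} n J xs → d ∣ gcdE n J xs ⇔ (d ∣ n × All (λ j → d ∣ e j xs) J)
∣gcdE⇔ n []      xs = mk⇔ (_, []) proj₁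
∣gcdE⇔ n (j ∷ J) xs = mk⇔ to from
  where
  to : ∀ {d} → d ∣ gcdE n (j ∷ J) xs → d ∣ n × All (λ j → d ∣ e j xs) (j ∷ J)
  to d∣g with Equivalence.to (∣gcdE⇔ n J xs) (∣-trans d∣g (gcd[m,n]∣n (e j xs) (gcdE n J xs)))
  ... | d∣n , d∣es = d∣n , ∣-trans d∣g (gcd[m,n]∣m (e j xs) (gcdE n J xs)) ∷ d∣es
  from : ∀ {d} → d ∣ n × All (λ j → d ∣ e j xs) (j ∷ J) → d ∣ gcdE n (j ∷ J) xs
  from (d∣n , d∣e ∷ d∣es) = gcd-greatest d∣e (Equivalence.from (∣gcdE⇔ n J xs) (d∣n , d∣es))

-- As in `jordan`, a prime p is represented by its predecessor i = p − 1.
isPrimeDivisor? : ∀ n i → Dec (Prime (suc i) × suc i ∣ n)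
isPrimeDivisor? n i = prime? (suc i) ×-dec (suc i ∣? n)

primeDivisors : ℕ → List ℕ
primeDivisors n = filter (isPrimeDivisor? n) (upTo n)

primeDivisors-unique : ∀ n → Unique (primeDivisors n)
primeDivisors-unique n = filter⁺ (isPrimeDivisor? n) (upTo⁺ n)

primeDivisors-prime : ∀ n → All (λ i → Prime (suc i) × suc i ∣ n) (primeDivisors n)
primeDivisors-prime n = all-filter (isPrimeDivisor? n) (upTo n)

All-primeDivisors⇔ : ∀ n .{{_ : NonZero n}} {Q : ℕ → Set} →
                     All (Q ∘ suc) (primeDivisors n) ⇔ (∀ {p} → Prime p → p ∣ n → Q p)
All-primeDivisors⇔ n = mk⇔ to from
  where
  to : ∀ {Q : ℕ → Set} → All (Q ∘ suc) (primeDivisors n) → ∀ {p} → Prime p → p ∣ n → Q p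
  to _   {zero}  p-prime _   = contradiction p-prime ¬prime[0]
  to all {suc i} p-prime p∣n = lookup all (∈-filter⁺ (isPrimeDivisor? n) (∈-upTo⁺ (∣⇒≤ p∣n)) (p-prime , p∣n))
  from : ∀ {Q : ℕ → Set} → (∀ {p} → Prime p → p ∣ n → Q p) → All (Q ∘ suc) (primeDivisors n)
  from h = All.tabulate λ i∈ → let p-prime , p∣n = proj₂ (∈-filter⁻ (isPrimeDivisor? n) {xs = upTo n} i∈)
                               in h p-prime p∣n

Avoids : List ℕ → List ℕ → Set
Avoids I xs = All (λ i → ¬ All (suc i ∣_) xs) I

avoids? : ∀ I xs → Dec (Avoids I xs)
avoids? I xs = all? (λ i → ¬? (all? (suc i ∣?_) xs)) I

gcdE≡1⇔Avoids : ∀ n .{{_ : NonZero n}} xs → gcdE n (fullJ (length xs)) xs ≡ 1 ⇔ Avoids (primeDivisors n) xs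
gcdE≡1⇔Avoids n xs = begin
  gcdE n J xs ≡ 1                                ∼⟨ ≡1⇔no-prime-divisor (gcdE n J xs) ⟩
  (∀ {p} → Prime p → ¬ p ∣ gcdE n J xs)          ∼⟨ mk⇔ ¬∣gcdE⇒avoids avoids⇒¬∣gcdE ⟩
  (∀ {p} → Prime p → p ∣ n → ¬ All (p ∣_) xs)   ∼⟨ ⇔-sym (All-primeDivisors⇔ n) ⟩
  Avoids (primeDivisors n) xs                    ∎
  where
  open EquationalReasoning
  J = fullJ (length xs)
  ¬∣gcdE⇒avoids : (∀ {p} → Prime p → ¬ p ∣ gcdE n J xs) → ∀ {p} → Prime p → p ∣ n → ¬ All (p ∣_) xs
  ¬∣gcdE⇒avoids h p-prime p∣n p∣xs =
    h p-prime (Equivalence.from (∣gcdE⇔ n J xs) (p∣n , Equivalence.from (∣e⇔All∣ p-prime xs) p∣xs))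
  avoids⇒¬∣gcdE : (∀ {p} → Prime p → p ∣ n → ¬ All (p ∣_) xs) → ∀ {p} → Prime p → ¬ p ∣ gcdE n J xs
  avoids⇒¬∣gcdE h p-prime p∣g with Equivalence.to (∣gcdE⇔ n J xs) p∣g
  ... | p∣n , p∣e = h p-prime p∣n (Equivalence.to (∣e⇔All∣ p-prime xs) p∣e)

φ≡∑Tuples : ∀ k J n → φ k J n ≡ ∑Tuples k n (λ xs → 𝟙[ gcdE n J xs ≟ℕ 1 ])
φ≡∑Tuples k J n = trans (length-filter≡sum-𝟙 _ (allTuples k n)) (sum-allTuples k n _)

-- Sieving out one prime

𝟙Avoids : List ℕ → List ℕ → ℕ
𝟙Avoids I xs = 𝟙[ avoids? I xs ]

All-replace : ∀ {A : Set} {P : A → Set} pre {x y post} →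
              (P y → P x) → All P (pre ++ y ∷ post) → All P (pre ++ x ∷ post)
All-replace []        f (py ∷ ps) = f py ∷ ps
All-replace (_ ∷ pre) f (pz ∷ ps) = pz ∷ All-replace pre f ps

All-map⇔ : ∀ {A : Set} {P : A → Set} {f : A → A} {xs} →
           (∀ {x} → P (f x) ⇔ P x) → All P (map f xs) ⇔ All P xs
All-map⇔ eq = mk⇔ (All.map (Equivalence.to eq) ∘ map⁻) (map⁺ ∘ All.map (Equivalence.from eq))

𝟙Avoids-cong : ∀ {I xs ys} → All (λ i → All (suc i ∣_) xs ⇔ All (suc i ∣_) ys) I →
               𝟙Avoids I xs ≡ 𝟙Avoids I ys
𝟙Avoids-cong eqs = 𝟙-cong (mk⇔ (λ ¬xs → zipWith (λ (eq , ¬x) → ¬x ∘ Equivalence.from eq) (eqs , ¬xs))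
                                 (λ ¬ys → zipWith (λ (eq , ¬y) → ¬y ∘ Equivalence.to eq) (eqs , ¬ys))) _ _

𝟙Avoids-periodic : ∀ {m} I → All (λ i → suc i ∣ m) I → Periodic m (𝟙Avoids I)
𝟙Avoids-periodic {m} I I∣m pre x post = 𝟙Avoids-cong (All.map shift I∣m)
  where
  shift : ∀ {d} → d ∣ m → All (d ∣_) (pre ++ m + x ∷ post) ⇔ All (d ∣_) (pre ++ x ∷ post)
  shift d∣m = mk⇔ (All-replace pre (Equivalence.to (∣m+n⇔∣n d∣m)))
                  (All-replace pre (Equivalence.from (∣m+n⇔∣n d∣m)))

𝟙Avoids-scale : ∀ {p} I → All (λ i → Prime (suc i) × ¬ suc i ∣ p) I →
                ∀ ys → 𝟙Avoids I (map (p *_) ys) ≡ 𝟙Avoids I ys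
𝟙Avoids-scale I I∤p ys =
  𝟙Avoids-cong (All.map (λ (q-prime , q∤p) → All-map⇔ (prime∣m*n⇔∣n q-prime q∤p)) I∤p)

𝟙Avoids-∷ : ∀ i I xs → 𝟙Avoids (i ∷ I) xs + 𝟙[ all? (suc i ∣?_) xs ] * 𝟙Avoids I xs ≡ 𝟙Avoids I xs
𝟙Avoids-∷ i I xs =
  trans (cong (_+ 𝟙[ all? (suc i ∣?_) xs ] * 𝟙Avoids I xs) (𝟙-all?-∷ (λ j → ¬? (all? (suc j ∣?_) xs)) i I))
        (𝟙[¬?]*n+𝟙*n≡n (all? (suc i ∣?_) xs) (𝟙Avoids I xs))

m+n≡o*n⇒m≡[o∸1]*n : ∀ m n o → m + n ≡ o * n → m ≡ (o ∸ 1) * n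
m+n≡o*n⇒m≡[o∸1]*n m n o eq = begin
  m              ≡⟨ m+n∸n≡m m n ⟨
  m + n ∸ n      ≡⟨ cong (_∸ n) eq ⟩
  o * n ∸ n      ≡⟨ cong (o * n ∸_) (*-identityˡ n) ⟨
  o * n ∸ 1 * n  ≡⟨ *-distribʳ-∸ n o 1 ⟨
  (o ∸ 1) * n    ∎
  where open ≡-Reasoning

module _ (k m d : ℕ) (I : List ℕ) (I∣m : All (λ i → suc i ∣ m) I) where

  private
    p = suc d

  ∑𝟙Avoids-periodic : ∑Tuples k (m * p) (𝟙Avoids I) ≡ p ^ k * ∑Tuples k m (𝟙Avoids I)
  ∑𝟙Avoids-periodic = trans (cong (λ n → ∑Tuples k n (𝟙Avoids I)) (*-comm m p))
                            (∑Tuples-periodic k p m (𝟙Avoids-periodic I I∣m))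

  ∑𝟙Avoids-sieve : All (λ i → Prime (suc i) × ¬ suc i ∣ p) I →
                   ∑Tuples k (m * p) (𝟙Avoids (d ∷ I)) ≡ (p ^ k ∸ 1) * ∑Tuples k m (𝟙Avoids I)
  ∑𝟙Avoids-sieve I∤p = m+n≡o*n⇒m≡[o∸1]*n _ _ (p ^ k) (begin
    ∑Tuples k (m * p) (𝟙Avoids (d ∷ I)) + ∑Tuples k m (𝟙Avoids I)
      ≡⟨ cong₂ _+_ refl multiples ⟨
    ∑Tuples k (m * p) (𝟙Avoids (d ∷ I)) + ∑Tuples k (m * p) (λ xs → 𝟙[ all? (p ∣?_) xs ] * 𝟙Avoids I xs)
      ≡⟨ ∑Tuples-distrib-+ k (m * p) _ _ ⟨
    ∑Tuples k (m * p) (λ xs → 𝟙Avoids (d ∷ I) xs + 𝟙[ all? (p ∣?_) xs ] * 𝟙Avoids I xs)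
      ≡⟨ ∑Tuples-cong k (m * p) (λ {xs} _ → 𝟙Avoids-∷ d I xs) ⟩
    ∑Tuples k (m * p) (𝟙Avoids I)
      ≡⟨ ∑𝟙Avoids-periodic ⟩
    p ^ k * ∑Tuples k m (𝟙Avoids I)
      ∎)
    where
    open ≡-Reasoning
    multiples : ∑Tuples k (m * p) (λ xs → 𝟙[ all? (p ∣?_) xs ] * 𝟙Avoids I xs) ≡ ∑Tuples k m (𝟙Avoids I)
    multiples = trans (∑Tuples-multiples k m d (𝟙Avoids I))
                      (∑Tuples-cong k m (λ {ys} _ → 𝟙Avoids-scale I I∤p ys))

-- The Euler product

ι : ℕ → ℚ
ι a = + a / 1

fromℚᵘ-homo-* : ∀ p q → fromℚᵘ (p ℚᵘ.* q) ≡ fromℚᵘ p *ℚ fromℚᵘ q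
fromℚᵘ-homo-* p q = ℚ.toℚᵘ-injective (begin
  toℚᵘ (fromℚᵘ (p ℚᵘ.* q))                ≈⟨ ℚ.toℚᵘ-fromℚᵘ (p ℚᵘ.* q) ⟩
  p ℚᵘ.* q                                ≈⟨ ℚᵘ.*-cong (ℚ.toℚᵘ-fromℚᵘ p) (ℚ.toℚᵘ-fromℚᵘ q) ⟨
  toℚᵘ (fromℚᵘ p) ℚᵘ.* toℚᵘ (fromℚᵘ q)    ≈⟨ ℚ.toℚᵘ-homo-* (fromℚᵘ p) (fromℚᵘ q) ⟨
  toℚᵘ (fromℚᵘ p *ℚ fromℚᵘ q)             ∎)
  where open ℚᵘ.≃-Reasoning

fromℚᵘ-homo-+ : ∀ p q → fromℚᵘ (p ℚᵘ.+ q) ≡ fromℚᵘ p +ℚ fromℚᵘ q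
fromℚᵘ-homo-+ p q = ℚ.toℚᵘ-injective (begin
  toℚᵘ (fromℚᵘ (p ℚᵘ.+ q))                ≈⟨ ℚ.toℚᵘ-fromℚᵘ (p ℚᵘ.+ q) ⟩
  p ℚᵘ.+ q                                ≈⟨ ℚᵘ.+-cong (ℚ.toℚᵘ-fromℚᵘ p) (ℚ.toℚᵘ-fromℚᵘ q) ⟨
  toℚᵘ (fromℚᵘ p) ℚᵘ.+ toℚᵘ (fromℚᵘ q)    ≈⟨ ℚ.toℚᵘ-homo-+ (fromℚᵘ p) (fromℚᵘ q) ⟨
  toℚᵘ (fromℚᵘ p +ℚ fromℚᵘ q)             ∎)
  where open ℚᵘ.≃-Reasoning

ι-* : ∀ a b → ι (a * b) ≡ ι a *ℚ ι b
ι-* a b = trans (cong (_/ 1) (ℤ.pos-* a b)) (fromℚᵘ-homo-* (ℚᵘ.mkℚᵘ (+ a) 0) (ℚᵘ.mkℚᵘ (+ b) 0))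

ι-+ : ∀ a b → ι (a + b) ≡ ι a +ℚ ι b
ι-+ a b = trans (cong (_/ 1) numerator) (fromℚᵘ-homo-+ (ℚᵘ.mkℚᵘ (+ a) 0) (ℚᵘ.mkℚᵘ (+ b) 0))
  where
  numerator : + (a + b) ≡ + a ℤ.* + 1 ℤ.+ + b ℤ.* + 1
  numerator = trans (ℤ.pos-+ a b) (sym (cong₂ ℤ._+_ (ℤ.*-identityʳ (+ a)) (ℤ.*-identityʳ (+ b))))

1/n*ι[n]≡1 : ∀ n .{{_ : NonZero n}} → (+ 1 / n) *ℚ ι n ≡ 1ℚ
1/n*ι[n]≡1 (suc n) = trans (sym (fromℚᵘ-homo-* (ℚᵘ.1/ m) m)) (ℚ.fromℚᵘ-cong (ℚᵘ.*-inverseˡ m))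
  where m = ℚᵘ.mkℚᵘ (+ suc n) 0

[1-1/n]*ι[n*u] : ∀ n .{{_ : NonZero n}} u → (1ℚ - + 1 / n) *ℚ ι (n * u) ≡ ι ((n ∸ 1) * u)
[1-1/n]*ι[n*u] n@(suc b) u = begin
  (1ℚ - r) *ℚ ι (n * u)                ≡⟨ cong ((1ℚ - r) *ℚ_) (ι-* n u) ⟩
  (1ℚ - r) *ℚ (ι n *ℚ ι u)             ≡⟨ expand r (ι n) (ι u) ⟩
  ι n *ℚ ι u - (r *ℚ ι n) *ℚ ι u       ≡⟨ cong (λ t → ι n *ℚ ι u - t *ℚ ι u) (1/n*ι[n]≡1 n) ⟩
  ι n *ℚ ι u - 1ℚ *ℚ ι u               ≡⟨ cong (λ t → t *ℚ ι u - 1ℚ *ℚ ι u) (ι-+ 1 b) ⟩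
  (1ℚ +ℚ ι b) *ℚ ι u - 1ℚ *ℚ ι u       ≡⟨ cancel (ι b) (ι u) ⟩
  ι b *ℚ ι u                           ≡⟨ ι-* b u ⟨
  ι (b * u)                            ∎
  where
  open ≡-Reasoning
  open Data.Rational.Solver.+-*-Solver
  r = + 1 / n
  expand : ∀ r a u → (1ℚ - r) *ℚ (a *ℚ u) ≡ a *ℚ u - (r *ℚ a) *ℚ u
  expand = solve 3 (λ r a u → (con 1ℚ :- r) :* (a :* u) := a :* u :- (r :* a) :* u) refl
  cancel : ∀ b u → (1ℚ +ℚ b) *ℚ u - 1ℚ *ℚ u ≡ b *ℚ u
  cancel = solve 2 (λ b u → (con 1ℚ :+ b) :* u :- con 1ℚ :* u := b :* u) refl

eulerProduct : ℕ → List ℕ → ℚ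
eulerProduct k I = foldr (λ i acc → (1ℚ - recipPow i k) *ℚ acc) 1ℚ I

∑𝟙Avoids≡n^k*eulerProduct : ∀ k n I → Unique I → All (λ i → Prime (suc i) × suc i ∣ n) I →
                            ι (∑Tuples k n (𝟙Avoids I)) ≡ ι (n ^ k) *ℚ eulerProduct k I
∑𝟙Avoids≡n^k*eulerProduct k n [] _ _ = trans (cong ι (∑Tuples-1 k n)) (sym (ℚ.*-identityʳ (ι (n ^ k))))
∑𝟙Avoids≡n^k*eulerProduct k n (d ∷ I) (d∉I ∷ I-unique) ((p-prime , divides m n≡m*p) ∷ I-primes) = begin
  ι (∑Tuples k n (𝟙Avoids (d ∷ I)))      ≡⟨ cong ι (∑n≡∑[m*p] (∑𝟙Avoids-sieve k m d I I∣m I∤p)) ⟩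
  ι ((p ^ k ∸ 1) * U)                    ≡⟨ [1-1/n]*ι[n*u] (p ^ k) {{m^n≢0 p k}} U ⟨
  c *ℚ ι (p ^ k * U)                     ≡⟨ cong (λ t → c *ℚ ι t) (∑n≡∑[m*p] (∑𝟙Avoids-periodic k m d I I∣m)) ⟨
  c *ℚ ι (∑Tuples k n (𝟙Avoids I))       ≡⟨ cong (c *ℚ_) (∑𝟙Avoids≡n^k*eulerProduct k n I I-unique I-primes) ⟩
  c *ℚ (ι (n ^ k) *ℚ eulerProduct k I)   ≡⟨ swap c (ι (n ^ k)) (eulerProduct k I) ⟩
  ι (n ^ k) *ℚ (c *ℚ eulerProduct k I)   ∎
  where
  open ≡-Reasoning
  p = suc d
  c = 1ℚ - recipPow d k
  U = ∑Tuples k m (𝟙Avoids I)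
  ∑n≡∑[m*p] : ∀ {w x} → ∑Tuples k (m * p) w ≡ x → ∑Tuples k n w ≡ x
  ∑n≡∑[m*p] {w} = trans (cong (λ n → ∑Tuples k n w) n≡m*p)
  I∤p : All (λ i → Prime (suc i) × ¬ suc i ∣ p) I
  I∤p = zipWith (λ ((q-prime , _) , d≢i) → q-prime , prime∤prime q-prime p-prime (d≢i ∘ sym ∘ suc-injective))
                (I-primes , d∉I)
  I∣m : All (λ i → suc i ∣ m) I
  I∣m = zipWith (λ ((_ , q∣n) , (q-prime , q∤p)) →
                   Equivalence.to (prime∣m*n⇔∣n q-prime q∤p) (subst (_ ∣_) (trans n≡m*p (*-comm m p)) q∣n))
                (I-primes , I∤p)
  swap : ∀ x y z → x *ℚ (y *ℚ z) ≡ y *ℚ (x *ℚ z)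
  swap = solve 3 (λ x y z → x :* (y :* z) := y :* (x :* z)) refl
    where open Data.Rational.Solver.+-*-Solver

mainTheorem7 : (k : ℕ) → 1 ≤ k → (n : ℕ) → 1 ≤ n →
    (+ (φ k (fullJ k) n)) / 1 ≡ jordan k n
mainTheorem7 k _ n 1≤n = begin
  ι (φ k (fullJ k) n)                                      ≡⟨ cong ι (φ≡∑Tuples k (fullJ k) n) ⟩
  ι (∑Tuples k n (λ xs → 𝟙[ gcdE n (fullJ k) xs ≟ℕ 1 ]))  ≡⟨ cong ι (∑Tuples-cong k n coprime≡avoids) ⟩
  ι (∑Tuples k n (𝟙Avoids (primeDivisors n)))              ≡⟨ ∑𝟙Avoids≡n^k*eulerProduct k n (primeDivisors n)
                                                                 (primeDivisors-unique n) (primeDivisors-prime n) ⟩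
  jordan k n                                               ∎
  where
  open ≡-Reasoning
  instance
    n≢0 : NonZero n
    n≢0 = >-nonZero 1≤n
  coprime≡avoids : ∀ {xs} → length xs ≡ k → 𝟙[ gcdE n (fullJ k) xs ≟ℕ 1 ] ≡ 𝟙Avoids (primeDivisors n) xs
  coprime≡avoids refl = 𝟙-cong (gcdE≡1⇔Avoids n _) _ _
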